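{- Let $r$ be a positive integer or $\infty$ and $n\ge0$. Each of the following is a basis of $\mathrm{NCQSym}^r_n(\mathbf{x})$: (1) $\{\mathbf{M}_{(\Phi,\Pi)}\}$ and (2) $\{\overline{\mathbf{F}}_{(\Phi,\Pi)}\}$, where $(\Phi,\Pi)$ ranges over all $r$-set-compositions of $[n]$.
   Context: Noncommuting variables $\mathbf{x}_1,\mathbf{x}_2,\dots$. An $r$-set-composition of $[n]$ is a pair $(\Phi,\Pi)$ with $\Phi=(\Phi_1|\cdots|\Phi_k)$ a set composition (sequence of disjoint nonempty sets) of some $A\subseteq[n]$ all of whose blocks have size $\ge r$, and $\Pi$ a set partition of $[n]-A$ all of whose blocks have size $<r$. $\mathbf{M}_{(\Phi,\Pi)}=\sum\mathbf{x}_{i_1}\cdots\mathbf{x}_{i_n}$ over all tuples with $i_j=i_k$ if and only if $j,k$ lie in the same block of $\Phi$ or of $\Pi$, and $i_j<i_k$ whenever $j\in\Phi_l$, $k\in\Phi_m$, $l<m$; $\mathrm{NCQSym}^r_n(\mathbf{x})$ is the $\mathbb{Q}$-span of these. $\overline{\mathbf{F}}_{(\Phi,\Pi)}$ is the generalized chromatic function $\mathscr{Y}_{(G,L)}(\mathbf{x})$ of the labelled edge-coloured digraph obtained as the dashed sum of (the double sum of $C_{\Phi_1},\dots,C_{\Phi_k}$) and (the dashed sum of $C_{\Pi_1},\dots,C_{\Pi_l}$); explicitly, $\overline{\mathbf{F}}_{(\Phi,\Pi)}=\sum\mathbf{x}_{i_1}\cdots\mathbf{x}_{i_n}$ over all tuples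 such that $i_j=i_k$ whenever $j,k$ lie in a common block of $\Phi$ or of $\Pi$, $i_j\le i_k$ whenever $j\in\Phi_p$, $k\in\Phi_q$, $p<q$, and $i_j\ne i_k$ whenever $j$ lies in a block of $\Pi$ and $k$ lies in a different block of $\Pi$ or in a block of $\Phi$. (Here $C_A$ is a directed cycle with double edges whose vertices are labelled by $A$, and the dashed/double sum adds an edge of that colour from every vertex of the first summand to every vertex of the second.) -}

module Defs where

open import Data.Nat using (ℕ; _≤_; _<_)
import Data.Nat.Properties as ℕP
open import Data.Unit using (⊤)
open import Data.Empty using (⊥)
open import Data.Fin using (Fin)
import Data.Fin as Fin
import Data.Fin.Properties as FinP
open import Data.Fin.Subset using (Subset; _∈_; ∣_∣; Nonempty)
open import Data.Fin.Subset.Properties using (_∈?_)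
open import Data.List using (List; []; _∷_; length; lookup; _++_)
open import Data.List.Relation.Unary.All using (All)
open import Data.List.Relation.Unary.AllPairs using (AllPairs)
open import Data.List.Relation.Binary.Permutation.Propositional using (_↭_)
open import Data.Product using (_×_; _,_; ∃; proj₁; proj₂)
open import Data.Sum using (_⊎_)
open import Data.Bool using (if_then_else_)
open import Data.Rational using (ℚ; 0ℚ; 1ℚ; _+_; _*_)
open import Relation.Nullary using (¬_; Dec; does)
open import Relation.Nullary.Decidable using (_×-dec_; _→-dec_; _⊎-dec_; ¬?)
open import Relation.Binary.PropositionalEquality using (_≡_; _≢_)

data ℕ∞ : Set where
  fin : ℕ → ℕ∞
  ∞   : ℕ∞

Positive : ℕ∞ → Set
Positive (fin r) = 1 ≤ r
Positive ∞       = ⊤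

AtLeast : ℕ∞ → ℕ → Set
AtLeast (fin r) s = r ≤ s
AtLeast ∞       s = ⊥

Below : ℕ∞ → ℕ → Set
Below (fin r) s = s < r
Below ∞       s = ⊤

-- r-set-compositions of [n]  (elements of [n] are Fin n).
-- Φ is the sequence of blocks of the set composition (in order);
-- Π is the list of blocks of the set partition (order irrelevant, see _≈_).

record RSC (r : ℕ∞) (n : ℕ) : Set where
  field
    Φ Π      : List (Subset n)
    nonempty : ∀ i → Nonempty (lookup (Φ ++ Π) i)
    disjoint : ∀ x i j → x ∈ lookup (Φ ++ Π) i → x ∈ lookup (Φ ++ Π) j → i ≡ j
    cover    : ∀ x → ∃ λ i → x ∈ lookup (Φ ++ Π) i
    bigΦ     : All (λ B → AtLeast r ∣ B ∣) Φ
    smallΠ   : All (λ B → Below r ∣ B ∣) Π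

open RSC public

_≈_ : ∀ {r n} → RSC r n → RSC r n → Set
σ ≈ τ = (Φ σ ≡ Φ τ) × (Π σ ↭ Π τ)

-- Homogeneous degree-n noncommutative series in x_0, x_1, x_2, ...
-- (variables indexed by ℕ in their natural order): the coefficient of the
-- monomial x_{w 0} x_{w 1} ... x_{w (n-1)} is  S w.

Word : ℕ → Set
Word n = Fin n → ℕ

Series : ℕ → Set
Series n = Word n → ℚ

indicator : ∀ {a} {A : Set a} → Dec A → ℚ
indicator d = if does d then 1ℚ else 0ℚ

module _ {r : ℕ∞} {n : ℕ} (σ : RSC r n) (w : Word n) where

  SameBlock : Fin n → Fin n → Set
  SameBlock j k = ∃ λ i → j ∈ lookup (Φ σ ++ Π σ) i × k ∈ lookup (Φ σ ++ Π σ) i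

  sameBlock? : ∀ j k → Dec (SameBlock j k)
  sameBlock? j k = FinP.any? λ i → (j ∈? lookup (Φ σ ++ Π σ) i) ×-dec (k ∈? lookup (Φ σ ++ Π σ) i)

  Ordered : (ℕ → ℕ → Set) → Set
  Ordered R = ∀ (l m : Fin (length (Φ σ))) → l Fin.< m → ∀ j k →
              j ∈ lookup (Φ σ) l → k ∈ lookup (Φ σ) m → R (w j) (w k)

  ordered? : (R : ℕ → ℕ → Set) → (∀ a b → Dec (R a b)) → Dec (Ordered R)
  ordered? R R? =
    FinP.all? λ l → FinP.all? λ m → (l Fin.<? m) →-dec
      (FinP.all? λ j → FinP.all? λ k → (j ∈? lookup (Φ σ) l) →-dec
        ((k ∈? lookup (Φ σ) m) →-dec R? (w j) (w k)))

  MCond : Set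
  MCond = (∀ j k → (w j ≡ w k → SameBlock j k) × (SameBlock j k → w j ≡ w k))
          × Ordered _<_

  MCond? : Dec MCond
  MCond? = FinP.all? (λ j → FinP.all? λ k →
             ((w j ℕP.≟ w k) →-dec sameBlock? j k) ×-dec (sameBlock? j k →-dec (w j ℕP.≟ w k)))
           ×-dec ordered? _<_ ℕP._<?_

  Separated : Set
  Separated = ∀ (p : Fin (length (Π σ))) j k → j ∈ lookup (Π σ) p →
              ((∃ λ q → q ≢ p × k ∈ lookup (Π σ) q) ⊎ (∃ λ l → k ∈ lookup (Φ σ) l)) →
              w j ≢ w k

  FCond : Set
  FCond = (∀ j k → SameBlock j k → w j ≡ w k) × Ordered _≤_ × Separated

  FCond? : Dec FCond
  FCond? = FinP.all? (λ j → FinP.all? λ k → sameBlock? j k →-dec (w j ℕP.≟ w k))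
           ×-dec ordered? _≤_ ℕP._≤?_
           ×-dec FinP.all? (λ p → FinP.all? λ j → FinP.all? λ k →
                  (j ∈? lookup (Π σ) p) →-dec
                  ((FinP.any? (λ q → ¬? (q FinP.≟ p) ×-dec (k ∈? lookup (Π σ) q))
                     ⊎-dec FinP.any? (λ l → k ∈? lookup (Φ σ) l))
                   →-dec ¬? (w j ℕP.≟ w k)))

𝐌 : ∀ {r n} → RSC r n → Series n
𝐌 σ w = indicator (MCond? σ w)

𝐅̄ : ∀ {r n} → RSC r n → Series n
𝐅̄ σ w = indicator (FCond? σ w)

lincomb : ∀ {r n} → (RSC r n → Series n) → List (ℚ × RSC r n) → Series n
lincomb f []             w = 0ℚ
lincomb f ((c , σ) ∷ L) w = c * f σ w + lincomb f L w

InSpan : ∀ {r n} → (RSC r n → Series n) → Series n → Set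
InSpan {r} {n} f S = ∃ λ (L : List (ℚ × RSC r n)) → ∀ w → S w ≡ lincomb f L w

NCQSym : (r : ℕ∞) (n : ℕ) → Series n → Set
NCQSym r n = InSpan {r} {n} 𝐌

LinIndep : ∀ {r n} → (RSC r n → Series n) → Set
LinIndep {r} {n} f = ∀ (L : List (ℚ × RSC r n)) →
  AllPairs (λ a b → ¬ (proj₂ a ≈ proj₂ b)) L →
  (∀ w → lincomb f L w ≡ 0ℚ) →
  All (λ a → proj₁ a ≡ 0ℚ) L

IsBasisOfNCQSym : (r : ℕ∞) (n : ℕ) → (RSC r n → Series n) → Set
IsBasisOfNCQSym r n f =
  (∀ σ → NCQSym r n (f σ)) × (∀ S → NCQSym r n S → InSpan f S) × LinIndep f

-- Deciding for each
-- weak step whether it is an equality gives F̄_σ = Σ_S M_σS over the coarsenings σS of σ that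
-- merge adjacent blocks of Φ, and inclusion–exclusion gives M_σ = Σ_S (-1)^|S| F̄_σS, so both
-- families span NCQSym. A word in the support of M_σ determines σ (its blocks are the level
-- sets), so evaluating at the word of block indices shows that the M's are independent.
-- Coarsening lowers the number of blocks of Φ, so the F̄'s are unitriangular against the M's
-- and independent as well.

module Submission where

open import Defs
open import Data.Nat using (ℕ)
open import Data.Product using (_×_)

open import Algebra.Bundles using (CommutativeMonoid)
open import Data.Bool using (Bool; true; false)
open import Data.Empty using (⊥; ⊥-elim)
open import Data.Fin as Fin using (Fin; toℕ)
import Data.Fin.Properties as FinP
open import Data.Fin.Subset using (Subset; _∈_; _∪_; _⊆_; Nonempty; ∣_∣)
open import Data.Fin.Subset.Properties using (_∈?_; x∈p∪q⁻; p⊆p∪q; q⊆p∪q; ∣p∣≤∣p∪q∣; ⊆-antisym)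
open import Data.List using (List; []; _∷_; length; lookup; _++_; map; replicate)
open import Data.List.Extrema.Nat using (max; xs≤max)
open import Data.List.Membership.Propositional using () renaming (_∈_ to _∈ₗ_)
open import Data.List.Membership.Propositional.Properties using (∈-lookup; ∈-map⁺)
open import Data.List.Membership.Propositional.Properties.WithK using (unique∧set⇒bag)
open import Data.List.Properties using (tabulate-lookup; length-replicate; length-map)
open import Data.List.Relation.Binary.BagAndSetEquality using (∼bag⇒↭)
open import Data.List.Relation.Binary.Permutation.Propositional using (↭-sym)
open import Data.List.Relation.Unary.All as All using (All; []; _∷_)
import Data.List.Relation.Unary.All.Properties as All
open import Data.List.Relation.Unary.Any as Any using (Any; here; there)
import Data.List.Relation.Unary.Any.Properties as Any
open import Data.List.Relation.Unary.AllPairs as AllPairs using (AllPairs; []; _∷_)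
import Data.List.Relation.Unary.AllPairs.Properties as AllPairs
open import Data.List.Relation.Unary.Unique.Propositional using (Unique)
open import Data.Nat as ℕ using (zero; suc; s≤s; _≤_; _<_)
import Data.Nat.Properties as ℕP
open import Data.Product using (_,_; ∃; proj₁; proj₂; swap)
open import Data.Rational using (ℚ; 0ℚ; 1ℚ; _+_; _*_; -_)
import Data.Rational.Properties as ℚP
open import Data.Sum using (_⊎_; inj₁; inj₂)
open import Data.Unit using (⊤; tt)
open import Data.Vec using (_∷_; []; here; there)
open import Function using (_∘_; _∘′_; id)
open import Function.Bundles using (mk⇔)
open import Relation.Binary using (tri<; tri≈; tri>)
open import Relation.Binary.PropositionalEquality
open import Relation.Nullary using (¬_; Dec; yes; no)
open import Relation.Nullary.Decidable using (_×-dec_; _→-dec_; _⊎-dec_; ¬?)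
open import Algebra.Properties.CommutativeSemigroup
  (CommutativeMonoid.commutativeSemigroup ℚP.*-1-commutativeMonoid)
  using (interchange; x∙yz≈y∙xz)

module _ {a p} {A : Set a} {P : A → Set p} where

  Any-fromLookup : ∀ xs → (∃ λ i → P (lookup xs i)) → Any P xs
  Any-fromLookup xs (i , pi) = subst (Any P) (tabulate-lookup xs) (Any.tabulate⁺ i pi)

  Any-toLookup : ∀ {xs} → Any P xs → ∃ λ i → P (lookup xs i)
  Any-toLookup a = Any.index a , Any.lookup-index a

  All-fromLookup : ∀ xs → (∀ i → P (lookup xs i)) → All P xs
  All-fromLookup xs f = subst (All P) (tabulate-lookup xs) (All.tabulate⁺ f)

  All-lookup : ∀ {xs} → All P xs → ∀ i → P (lookup xs i)
  All-lookup a i = All.lookup a (∈-lookup i)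

module _ {a ℓ} {A : Set a} {R : A → A → Set ℓ} where

  AllPairs-fromLookup≢ : ∀ xs → (∀ i j → i ≢ j → R (lookup xs i) (lookup xs j)) → AllPairs R xs
  AllPairs-fromLookup≢ xs f = subst (AllPairs R) (tabulate-lookup xs) (AllPairs.tabulate⁺ (f _ _))

  AllPairs-fromLookup< : ∀ xs → (∀ i j → i Fin.< j → R (lookup xs i) (lookup xs j)) → AllPairs R xs
  AllPairs-fromLookup< xs f = subst (AllPairs R) (tabulate-lookup xs) (AllPairs.tabulate⁺-< (f _ _))

  AllPairs-lookup< : ∀ {xs} → AllPairs R xs → ∀ i j → i Fin.< j → R (lookup xs i) (lookup xs j)
  AllPairs-lookup< (h ∷ _) Fin.zero (Fin.suc j) _ = All-lookup h j
  AllPairs-lookup< (_ ∷ t) (Fin.suc i) (Fin.suc j) (s≤s i<j) = AllPairs-lookup< t i j i<j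

  AllPairs-lookup≢ : (∀ {x y} → R x y → R y x) → ∀ {xs} → AllPairs R xs →
                     ∀ i j → i ≢ j → R (lookup xs i) (lookup xs j)
  AllPairs-lookup≢ R-sym ap i j i≢j with FinP.<-cmp i j
  ... | tri< i<j _ _ = AllPairs-lookup< ap i j i<j
  ... | tri≈ _ i≡j _ = ⊥-elim (i≢j i≡j)
  ... | tri> _ _ j<i = R-sym (AllPairs-lookup< ap j i j<i)

  AllPairs-++⁻ : ∀ xs {ys} → AllPairs R (xs ++ ys) →
                 AllPairs R xs × AllPairs R ys × All (λ x → All (R x) ys) xs
  AllPairs-++⁻ [] ap = [] , ap , []
  AllPairs-++⁻ (x ∷ xs) (h ∷ ap) =
    let (axs , ays , across) = AllPairs-++⁻ xs ap
        (hxs , hys) = All.++⁻ xs h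
    in hxs ∷ axs , ays , hys ∷ across

module _ {a p ℓ} {A : Set a} {P : A → Set p} {R : A → A → Set ℓ}
         (asym : ∀ {x y} → P x → P y → R x y → R y x → ⊥) where

  private
    ∈-tail : ∀ {x xs ys z} → P x → All (R x) xs → z ∈ₗ xs → z ∈ₗ x ∷ ys → z ∈ₗ ys
    ∈-tail px Rx z∈xs (here refl) = let Rxx = All.lookup Rx z∈xs in ⊥-elim (asym px px Rxx Rxx)
    ∈-tail px Rx z∈xs (there z∈ys) = z∈ys

  AllPairs-ext : ∀ {xs ys} → All P xs → All P ys → AllPairs R xs → AllPairs R ys →
                 (∀ {z} → z ∈ₗ xs → z ∈ₗ ys) → (∀ {z} → z ∈ₗ ys → z ∈ₗ xs) → xs ≡ ys
  AllPairs-ext {[]} {[]} _ _ _ _ _ _ = refl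
  AllPairs-ext {[]} {y ∷ ys} _ _ _ _ _ ys⊆ with () ← ys⊆ (here refl)
  AllPairs-ext {x ∷ xs} {[]} _ _ _ _ xs⊆ _ with () ← xs⊆ (here refl)
  AllPairs-ext {x ∷ xs} {y ∷ ys} (px ∷ pxs) (py ∷ pys) (Rx ∷ rxs) (Ry ∷ rys) xs⊆ ys⊆
    with heads-≡ (xs⊆ (here refl)) (ys⊆ (here refl))
    where
    heads-≡ : x ∈ₗ y ∷ ys → y ∈ₗ x ∷ xs → x ≡ y
    heads-≡ (here x≡y) _ = x≡y
    heads-≡ (there _) (here y≡x) = sym y≡x
    heads-≡ (there x∈ys) (there y∈xs) = ⊥-elim (asym px py (All.lookup Rx y∈xs) (All.lookup Ry x∈ys))
  ... | refl = cong (x ∷_) (AllPairs-ext pxs pys rxs rys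
                             (λ z∈xs → ∈-tail px Rx z∈xs (xs⊆ (there z∈xs)))
                             (λ z∈ys → ∈-tail py Ry z∈ys (ys⊆ (there z∈ys))))

module _ {a} {A : Set a} where

  indexˡ : ∀ (xs ys : List A) → Fin (length xs) → Fin (length (xs ++ ys))
  indexˡ (x ∷ xs) ys Fin.zero = Fin.zero
  indexˡ (x ∷ xs) ys (Fin.suc i) = Fin.suc (indexˡ xs ys i)

  indexʳ : ∀ (xs ys : List A) → Fin (length ys) → Fin (length (xs ++ ys))
  indexʳ [] ys i = i
  indexʳ (x ∷ xs) ys i = Fin.suc (indexʳ xs ys i)

  lookup-indexˡ : ∀ xs ys i → lookup (xs ++ ys) (indexˡ xs ys i) ≡ lookup xs i
  lookup-indexˡ (x ∷ xs) ys Fin.zero = refl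
  lookup-indexˡ (x ∷ xs) ys (Fin.suc i) = lookup-indexˡ xs ys i

  lookup-indexʳ : ∀ xs ys i → lookup (xs ++ ys) (indexʳ xs ys i) ≡ lookup ys i
  lookup-indexʳ [] ys i = refl
  lookup-indexʳ (x ∷ xs) ys i = lookup-indexʳ xs ys i

  toℕ-indexˡ : ∀ xs ys i → toℕ (indexˡ xs ys i) ≡ toℕ i
  toℕ-indexˡ (x ∷ xs) ys Fin.zero = refl
  toℕ-indexˡ (x ∷ xs) ys (Fin.suc i) = cong suc (toℕ-indexˡ xs ys i)

  index-++ : ∀ xs ys (i : Fin (length (xs ++ ys))) →
             (∃ λ l → i ≡ indexˡ xs ys l) ⊎ (∃ λ p → i ≡ indexʳ xs ys p)
  index-++ [] ys i = inj₂ (i , refl)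
  index-++ (x ∷ xs) ys Fin.zero = inj₁ (Fin.zero , refl)
  index-++ (x ∷ xs) ys (Fin.suc i) with index-++ xs ys i
  ... | inj₁ (l , e) = inj₁ (Fin.suc l , cong Fin.suc e)
  ... | inj₂ (p , e) = inj₂ (p , cong Fin.suc e)

  indexʳ-injective : ∀ xs ys {i j} → indexʳ xs ys i ≡ indexʳ xs ys j → i ≡ j
  indexʳ-injective [] ys e = e
  indexʳ-injective (x ∷ xs) ys e = indexʳ-injective xs ys (FinP.suc-injective e)

  indexˡ≢indexʳ : ∀ xs ys {i j} → indexˡ xs ys i ≢ indexʳ xs ys j
  indexˡ≢indexʳ (x ∷ xs) ys {Fin.zero} ()
  indexˡ≢indexʳ (x ∷ xs) ys {Fin.suc i} e = indexˡ≢indexʳ xs ys (FinP.suc-injective e)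

module _ {a} {A : Set a} where

  indicator-yes : A → (d : Dec A) → indicator d ≡ 1ℚ
  indicator-yes a (yes _) = refl
  indicator-yes a (no ¬a) = ⊥-elim (¬a a)

  indicator-no : ¬ A → (d : Dec A) → indicator d ≡ 0ℚ
  indicator-no ¬a (yes a) = ⊥-elim (¬a a)
  indicator-no ¬a (no _) = refl

  indicator≢0 : (d : Dec A) → indicator d ≢ 0ℚ → A
  indicator≢0 (yes a) _ = a
  indicator≢0 (no _) ne = ⊥-elim (ne refl)

module _ {a b} {A : Set a} {B : Set b} where

  indicator-cong : (A → B) → (B → A) → (d : Dec A) (e : Dec B) → indicator d ≡ indicator e
  indicator-cong f g (yes a) e = sym (indicator-yes (f a) e)
  indicator-cong f g (no ¬a) e = sym (indicator-no (λ b → ¬a (g b)) e)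

  indicator-× : (d : Dec A) (e : Dec B) →
                indicator (d ×-dec e) ≡ indicator d * indicator e
  indicator-× (yes _) (yes _) = refl
  indicator-× (yes _) (no _) = refl
  indicator-× (no _) (yes _) = refl
  indicator-× (no _) (no _) = refl

∑Bits : ℕ → (List Bool → ℚ) → ℚ
∑Bits zero f = f []
∑Bits (suc k) f = ∑Bits k (λ S → f (true ∷ S)) + ∑Bits k (λ S → f (false ∷ S))

∑Bits-cong : ∀ k {f g : List Bool → ℚ} → (∀ S → length S ≡ k → f S ≡ g S) → ∑Bits k f ≡ ∑Bits k g
∑Bits-cong zero eq = eq [] refl
∑Bits-cong (suc k) eq = cong₂ _+_ (∑Bits-cong k (λ S e → eq (true ∷ S) (cong suc e)))
                                  (∑Bits-cong k (λ S e → eq (false ∷ S) (cong suc e)))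

∑Bits-*ˡ : ∀ k c (f : List Bool → ℚ) → ∑Bits k (λ S → c * f S) ≡ c * ∑Bits k f
∑Bits-*ˡ zero c f = refl
∑Bits-*ˡ (suc k) c f = trans (cong₂ _+_ (∑Bits-*ˡ k c _) (∑Bits-*ˡ k c _))
                             (sym (ℚP.*-distribˡ-+ c _ _))

∑Bits≢0 : ∀ k (f : List Bool → ℚ) → ∑Bits k f ≢ 0ℚ → ∃ λ S → length S ≡ k × f S ≢ 0ℚ
∑Bits≢0 zero f ne = [] , refl , ne
∑Bits≢0 (suc k) f ne with ∑Bits k (λ S → f (true ∷ S)) ℚP.≟ 0ℚ | ∑Bits k (λ S → f (false ∷ S)) ℚP.≟ 0ℚ
... | no ne₁ | _ = let (S , e , q) = ∑Bits≢0 k _ ne₁ in true ∷ S , cong suc e , q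
... | yes _ | no ne₂ = let (S , e , q) = ∑Bits≢0 k _ ne₂ in false ∷ S , cong suc e , q
... | yes e₁ | yes e₂ = ⊥-elim (ne (cong₂ _+_ e₁ e₂))

tabulateBits : ∀ {a} {X : Set a} → ℕ → (List Bool → X) → List X
tabulateBits zero g = g [] ∷ []
tabulateBits (suc k) g = tabulateBits k (λ S → g (true ∷ S)) ++ tabulateBits k (λ S → g (false ∷ S))

weight : ℚ → List Bool → ℚ
weight a [] = 1ℚ
weight a (true ∷ S) = a * weight a S
weight a (false ∷ S) = weight a S

falses : ℕ → List Bool
falses k = replicate k false

ChainFrom : (ℕ → ℕ → Set) → List Bool → ℕ → List ℕ → Set
ChainFrom R [] x [] = ⊤
ChainFrom R [] x (y ∷ vs) = ⊥
ChainFrom R (b ∷ S) x [] = ⊥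
ChainFrom R (true ∷ S) x (y ∷ vs) = x ≡ y × ChainFrom R S y vs
ChainFrom R (false ∷ S) x (y ∷ vs) = R x y × ChainFrom R S y vs

Chain : (ℕ → ℕ → Set) → List Bool → List ℕ → Set
Chain R S [] = ⊤
Chain R S (x ∷ vs) = ChainFrom R S x vs

module _ {R : ℕ → ℕ → Set} (R? : ∀ x y → Dec (R x y)) where

  chainFrom? : ∀ S x vs → Dec (ChainFrom R S x vs)
  chainFrom? [] x [] = yes tt
  chainFrom? [] x (y ∷ vs) = no λ ()
  chainFrom? (b ∷ S) x [] = no λ ()
  chainFrom? (true ∷ S) x (y ∷ vs) = (x ℕP.≟ y) ×-dec chainFrom? S y vs
  chainFrom? (false ∷ S) x (y ∷ vs) = R? x y ×-dec chainFrom? S y vs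

  chain? : ∀ S vs → Dec (Chain R S vs)
  chain? S [] = yes tt
  chain? S (x ∷ vs) = chainFrom? S x vs

-- Inclusion–exclusion along a chain: summing over which steps are equalities turns R-steps into R′-steps.
module _ {R R′ : ℕ → ℕ → Set} (R? : ∀ x y → Dec (R x y)) (R′? : ∀ x y → Dec (R′ x y)) (a : ℚ)
         (split : ∀ x y → a * indicator (x ℕP.≟ y) + indicator (R? x y) ≡ indicator (R′? x y)) where

  ∑Bits-chainFrom : ∀ x vs →
    ∑Bits (length vs) (λ S → weight a S * indicator (chainFrom? R? S x vs))
      ≡ indicator (chainFrom? R′? (falses (length vs)) x vs)
  ∑Bits-chainFrom x [] = ℚP.*-identityˡ _
  ∑Bits-chainFrom x (y ∷ vs) = begin
      ∑Bits k (λ S → (a * weight a S) * indicator ((x ℕP.≟ y) ×-dec rest S))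
        + ∑Bits k (λ S → weight a S * indicator (R? x y ×-dec rest S))
    ≡⟨ cong₂ _+_ (∑Bits-cong k λ S _ → trans (cong (a * weight a S *_) (indicator-× (x ℕP.≟ y) (rest S)))
                                              (interchange a (weight a S) (indicator (x ℕP.≟ y)) (indicator (rest S))))
                 (∑Bits-cong k λ S _ → trans (cong (weight a S *_) (indicator-× (R? x y) (rest S)))
                                              (x∙yz≈y∙xz (weight a S) rel (indicator (rest S)))) ⟩
      ∑Bits k (λ S → eq * term S) + ∑Bits k (λ S → rel * term S)
    ≡⟨ cong₂ _+_ (∑Bits-*ˡ k eq term) (∑Bits-*ˡ k rel term) ⟩
      eq * ∑Bits k term + rel * ∑Bits k term
    ≡⟨ sym (ℚP.*-distribʳ-+ (∑Bits k term) eq rel) ⟩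
      (eq + rel) * ∑Bits k term
    ≡⟨ cong₂ _*_ (split x y) (∑Bits-chainFrom y vs) ⟩
      indicator (R′? x y) * indicator (chainFrom? R′? (falses k) y vs)
    ≡⟨ sym (indicator-× (R′? x y) (chainFrom? R′? (falses k) y vs)) ⟩
      indicator (chainFrom? R′? (falses (suc k)) x (y ∷ vs))
    ∎
    where
    open ≡-Reasoning
    k = length vs
    rest = λ S → chainFrom? R? S y vs
    term = λ S → weight a S * indicator (rest S)
    eq = a * indicator (x ℕP.≟ y)
    rel = indicator (R? x y)

  ∑Bits-chain : ∀ {k} vs → ℕ.pred (length vs) ≡ k →
    ∑Bits k (λ S → weight a S * indicator (chain? R? S vs)) ≡ indicator (chain? R′? (falses k) vs)
  ∑Bits-chain [] refl = ℚP.*-identityˡ _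
  ∑Bits-chain (x ∷ vs) refl = ∑Bits-chainFrom x vs

indicator-≟+<≡≤ : ∀ x y → 1ℚ * indicator (x ℕP.≟ y) + indicator (x ℕP.<? y) ≡ indicator (x ℕP.≤? y)
indicator-≟+<≡≤ x y with ℕP.<-cmp x y
... | tri< x<y x≢y _ rewrite indicator-no x≢y (x ℕP.≟ y) | indicator-yes x<y (x ℕP.<? y)
                           | indicator-yes (ℕP.<⇒≤ x<y) (x ℕP.≤? y) = refl
... | tri≈ _ x≡y _ rewrite indicator-yes x≡y (x ℕP.≟ y) | indicator-no (ℕP.<-irrefl x≡y) (x ℕP.<? y)
                           | indicator-yes (ℕP.≤-reflexive x≡y) (x ℕP.≤? y) = refl
... | tri> _ x≢y y<x rewrite indicator-no x≢y (x ℕP.≟ y) | indicator-no (ℕP.<-asym y<x) (x ℕP.<? y)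
                           | indicator-no (ℕP.<⇒≱ y<x) (x ℕP.≤? y) = refl

indicator-≤-≟≡< : ∀ x y → - 1ℚ * indicator (x ℕP.≟ y) + indicator (x ℕP.≤? y) ≡ indicator (x ℕP.<? y)
indicator-≤-≟≡< x y with ℕP.<-cmp x y
... | tri< x<y x≢y _ rewrite indicator-no x≢y (x ℕP.≟ y) | indicator-yes x<y (x ℕP.<? y)
                           | indicator-yes (ℕP.<⇒≤ x<y) (x ℕP.≤? y) = refl
... | tri≈ _ x≡y _ rewrite indicator-yes x≡y (x ℕP.≟ y) | indicator-no (ℕP.<-irrefl x≡y) (x ℕP.<? y)
                           | indicator-yes (ℕP.≤-reflexive x≡y) (x ℕP.≤? y) = refl
... | tri> _ x≢y y<x rewrite indicator-no x≢y (x ℕP.≟ y) | indicator-no (ℕP.<-asym y<x) (x ℕP.<? y)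
                           | indicator-no (ℕP.<⇒≱ y<x) (x ℕP.≤? y) = refl

-- Coarsening a sequence of blocks

module _ {n : ℕ} where

  -- A true in S merges the corresponding block into the block before it.
  coarsenFrom : List Bool → Subset n → List (Subset n) → List (Subset n)
  coarsenFrom [] B Cs = B ∷ Cs
  coarsenFrom (b ∷ S) B [] = B ∷ []
  coarsenFrom (true ∷ S) B (C ∷ Cs) = coarsenFrom S (B ∪ C) Cs
  coarsenFrom (false ∷ S) B (C ∷ Cs) = B ∷ coarsenFrom S C Cs

  coarsen : List Bool → List (Subset n) → List (Subset n)
  coarsen S [] = []
  coarsen S (B ∷ Cs) = coarsenFrom S B Cs

  module _ {p} {P : Subset n → Set p} (P-∪ : ∀ {B C} → P B → P C → P (B ∪ C)) where

    All-coarsenFrom : ∀ S B Cs → All P (B ∷ Cs) → All P (coarsenFrom S B Cs)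
    All-coarsenFrom [] B Cs ps = ps
    All-coarsenFrom (b ∷ S) B [] ps = ps
    All-coarsenFrom (true ∷ S) B (C ∷ Cs) (pB ∷ pC ∷ ps) = All-coarsenFrom S (B ∪ C) Cs (P-∪ pB pC ∷ ps)
    All-coarsenFrom (false ∷ S) B (C ∷ Cs) (pB ∷ ps) = pB ∷ All-coarsenFrom S C Cs ps

    All-coarsen : ∀ S Bs → All P Bs → All P (coarsen S Bs)
    All-coarsen S [] ps = ps
    All-coarsen S (B ∷ Cs) ps = All-coarsenFrom S B Cs ps

  module _ {q} {Q : Subset n → Subset n → Set q}
           (Q-∪ˡ : ∀ {B C D} → Q B D → Q C D → Q (B ∪ C) D)
           (Q-∪ʳ : ∀ {B C D} → Q D B → Q D C → Q D (B ∪ C)) where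

    AllPairs-coarsenFrom : ∀ S B Cs → AllPairs Q (B ∷ Cs) → AllPairs Q (coarsenFrom S B Cs)
    AllPairs-coarsenFrom [] B Cs qs = qs
    AllPairs-coarsenFrom (b ∷ S) B [] qs = qs
    AllPairs-coarsenFrom (true ∷ S) B (C ∷ Cs) ((_ ∷ qB) ∷ qC ∷ qs) =
      AllPairs-coarsenFrom S (B ∪ C) Cs (All.zipWith (λ (x , y) → Q-∪ˡ x y) (qB , qC) ∷ qs)
    AllPairs-coarsenFrom (false ∷ S) B (C ∷ Cs) (qB ∷ qs) =
      All-coarsenFrom Q-∪ʳ S C Cs qB ∷ AllPairs-coarsenFrom S C Cs qs

    AllPairs-coarsen : ∀ S Bs → AllPairs Q Bs → AllPairs Q (coarsen S Bs)
    AllPairs-coarsen S [] qs = qs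
    AllPairs-coarsen S (B ∷ Cs) qs = AllPairs-coarsenFrom S B Cs qs

  module _ {x : Fin n} where

    ∈-coarsenFrom⁺ : ∀ S B Cs → Any (x ∈_) (B ∷ Cs) → Any (x ∈_) (coarsenFrom S B Cs)
    ∈-coarsenFrom⁺ [] B Cs m = m
    ∈-coarsenFrom⁺ (b ∷ S) B [] m = m
    ∈-coarsenFrom⁺ (true ∷ S) B (C ∷ Cs) (here m) = ∈-coarsenFrom⁺ S (B ∪ C) Cs (here (p⊆p∪q C m))
    ∈-coarsenFrom⁺ (true ∷ S) B (C ∷ Cs) (there (here m)) = ∈-coarsenFrom⁺ S (B ∪ C) Cs (here (q⊆p∪q B C m))
    ∈-coarsenFrom⁺ (true ∷ S) B (C ∷ Cs) (there (there m)) = ∈-coarsenFrom⁺ S (B ∪ C) Cs (there m)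
    ∈-coarsenFrom⁺ (false ∷ S) B (C ∷ Cs) (here m) = here m
    ∈-coarsenFrom⁺ (false ∷ S) B (C ∷ Cs) (there m) = there (∈-coarsenFrom⁺ S C Cs m)

    ∈-coarsenFrom⁻ : ∀ S B Cs → Any (x ∈_) (coarsenFrom S B Cs) → Any (x ∈_) (B ∷ Cs)
    ∈-coarsenFrom⁻ [] B Cs m = m
    ∈-coarsenFrom⁻ (b ∷ S) B [] m = m
    ∈-coarsenFrom⁻ (true ∷ S) B (C ∷ Cs) m with ∈-coarsenFrom⁻ S (B ∪ C) Cs m
    ... | there m′ = there (there m′)
    ... | here m′ with x∈p∪q⁻ B C m′
    ...   | inj₁ x∈B = here x∈B
    ...   | inj₂ x∈C = there (here x∈C)
    ∈-coarsenFrom⁻ (false ∷ S) B (C ∷ Cs) (here m) = here m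
    ∈-coarsenFrom⁻ (false ∷ S) B (C ∷ Cs) (there m) = there (∈-coarsenFrom⁻ S C Cs m)

    ∈-coarsen⁺ : ∀ S Bs → Any (x ∈_) Bs → Any (x ∈_) (coarsen S Bs)
    ∈-coarsen⁺ S (B ∷ Cs) m = ∈-coarsenFrom⁺ S B Cs m

    ∈-coarsen⁻ : ∀ S Bs → Any (x ∈_) (coarsen S Bs) → Any (x ∈_) Bs
    ∈-coarsen⁻ S (B ∷ Cs) m = ∈-coarsenFrom⁻ S B Cs m

  head-coarsenFrom : ∀ {p} {P : Subset n → Set p} S B Cs → All P (coarsenFrom S B Cs) →
                     ∃ λ D → B ⊆ D × P D
  head-coarsenFrom [] B Cs (pD ∷ _) = B , (λ m → m) , pD
  head-coarsenFrom (b ∷ S) B [] (pD ∷ _) = B , (λ m → m) , pD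
  head-coarsenFrom (true ∷ S) B (C ∷ Cs) ps =
    let (D , B∪C⊆D , pD) = head-coarsenFrom S (B ∪ C) Cs ps in D , (λ m → B∪C⊆D (p⊆p∪q C m)) , pD
  head-coarsenFrom (false ∷ S) B (C ∷ Cs) (pD ∷ _) = B , (λ m → m) , pD

  length-coarsenFrom : ∀ S B Cs → length (coarsenFrom S B Cs) ≤ suc (length Cs)
  length-coarsenFrom [] B Cs = ℕP.≤-refl
  length-coarsenFrom (b ∷ S) B [] = ℕP.≤-refl
  length-coarsenFrom (true ∷ S) B (C ∷ Cs) = ℕP.m≤n⇒m≤1+n (length-coarsenFrom S (B ∪ C) Cs)
  length-coarsenFrom (false ∷ S) B (C ∷ Cs) = s≤s (length-coarsenFrom S C Cs)

  coarsenFrom-≥ : ∀ S B Cs → suc (length Cs) ≤ length (coarsenFrom S B Cs) → coarsenFrom S B Cs ≡ B ∷ Cs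
  coarsenFrom-≥ [] B Cs _ = refl
  coarsenFrom-≥ (b ∷ S) B [] _ = refl
  coarsenFrom-≥ (true ∷ S) B (C ∷ Cs) h =
    ⊥-elim (ℕP.<-irrefl refl (ℕP.≤-trans h (length-coarsenFrom S (B ∪ C) Cs)))
  coarsenFrom-≥ (false ∷ S) B (C ∷ Cs) (s≤s h) = cong (B ∷_) (coarsenFrom-≥ S C Cs h)

  coarsen-≥ : ∀ S Bs → length Bs ≤ length (coarsen S Bs) → coarsen S Bs ≡ Bs
  coarsen-≥ S [] _ = refl
  coarsen-≥ S (B ∷ Cs) h = coarsenFrom-≥ S B Cs h

  coarsenFrom-falses : ∀ B Cs → coarsenFrom (falses (length Cs)) B Cs ≡ B ∷ Cs
  coarsenFrom-falses B [] = refl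
  coarsenFrom-falses B (C ∷ Cs) = cong (B ∷_) (coarsenFrom-falses C Cs)

  coarsen-falses : ∀ Bs → coarsen (falses (ℕ.pred (length Bs))) Bs ≡ Bs
  coarsen-falses [] = refl
  coarsen-falses (B ∷ Cs) = coarsenFrom-falses B Cs

-- The value at the first element; junk (0) on the empty subset.
rep : ∀ {n} → Word n → Subset n → ℕ
rep {zero} w [] = 0
rep {suc n} w (true ∷ B) = w Fin.zero
rep {suc n} w (false ∷ B) = rep (λ i → w (Fin.suc i)) B

module _ {n : ℕ} (w : Word n) where

  Attains : Subset n → ℕ → Set
  Attains B x = ∃ λ j → j ∈ B × w j ≡ x

  Const : Subset n → Set
  Const B = ∀ j k → j ∈ B → k ∈ B → w j ≡ w k

  Rel : (ℕ → ℕ → Set) → Subset n → Subset n → Set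
  Rel R B C = ∀ j k → j ∈ B → k ∈ C → R (w j) (w k)

  LowerBound : ℕ → Subset n → Set
  LowerBound y B = ∀ k → k ∈ B → y ≤ w k

  reps : List (Subset n) → List ℕ
  reps = map (rep w)

rep-attains : ∀ {n} (w : Word n) {B} → Nonempty B → Attains w B (rep w B)
rep-attains {suc n} w {true ∷ B} _ = Fin.zero , here , refl
rep-attains {suc n} w {false ∷ B} (Fin.suc j , there j∈B) =
  let (k , k∈B , e) = rep-attains (λ i → w (Fin.suc i)) (j , j∈B) in Fin.suc k , there k∈B , e

module _ {n : ℕ} {w : Word n} where

  Const-attains : ∀ {B x} → Const w B → Attains w B x → ∀ j → j ∈ B → w j ≡ x
  Const-attains c (j₀ , j₀∈B , e) j j∈B = trans (c j j₀ j∈B j₀∈B) e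

  Attains-∪ʳ : ∀ {B C y} → Attains w C y → Attains w (B ∪ C) y
  Attains-∪ʳ {B} {C} (j , j∈C , e) = j , q⊆p∪q B C j∈C , e

  LowerBound-∪ : ∀ {y B C} → LowerBound w y B → LowerBound w y C → LowerBound w y (B ∪ C)
  LowerBound-∪ {B = B} {C} lB lC k k∈B∪C with x∈p∪q⁻ B C k∈B∪C
  ... | inj₁ k∈B = lB k k∈B
  ... | inj₂ k∈C = lC k k∈C

module _ {n : ℕ} (w : Word n) {R : ℕ → ℕ → Set}
         (R-≤-trans : ∀ {a b c} → R a b → b ≤ c → R a c) (R⇒≤ : ∀ {a b} → R a b → a ≤ b) where

  chainFrom⇒lowerBound : ∀ S y vs → ChainFrom R S y vs → All (y ≤_) vs
  chainFrom⇒lowerBound [] y [] _ = []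
  chainFrom⇒lowerBound (true ∷ S) y (z ∷ vs) (refl , ch) = ℕP.≤-refl ∷ chainFrom⇒lowerBound S z vs ch
  chainFrom⇒lowerBound (false ∷ S) y (z ∷ vs) (r , ch) =
    R⇒≤ r ∷ All.map (ℕP.≤-trans (R⇒≤ r)) (chainFrom⇒lowerBound S z vs ch)

  coarsenFrom⇒chain : ∀ S B Cs {x} → length S ≡ length Cs → Attains w B x → All Nonempty Cs →
    All (Const w) (coarsenFrom S B Cs) → AllPairs (Rel w R) (coarsenFrom S B Cs) →
    All (Const w) (B ∷ Cs) × ChainFrom R S x (reps w Cs)
  coarsenFrom⇒chain [] B [] _ _ _ cs _ = cs , tt
  coarsenFrom⇒chain (true ∷ S) B (C ∷ Cs) {x} e xB (neC ∷ ne) cs ap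
    with coarsenFrom⇒chain S (B ∪ C) Cs (ℕP.suc-injective e) (Attains-∪ʳ (rep-attains w neC)) ne cs ap
  ... | cBC ∷ cs′ , ch = cB ∷ cC ∷ cs′ , x≡y , ch
    where
    yC : Attains w C (rep w C)
    yC = rep-attains w neC
    cB : Const w B
    cB j k j∈B k∈B = cBC j k (p⊆p∪q C j∈B) (p⊆p∪q C k∈B)
    cC : Const w C
    cC j k j∈C k∈C = cBC j k (q⊆p∪q B C j∈C) (q⊆p∪q B C k∈C)
    x≡y : x ≡ rep w C
    x≡y = let (j , j∈B , wj≡x) = xB in
          trans (sym wj≡x) (Const-attains cBC (Attains-∪ʳ yC) j (p⊆p∪q C j∈B))
  coarsenFrom⇒chain (false ∷ S) B (C ∷ Cs) {x} e xB (neC ∷ ne) (cB ∷ cs) (relB ∷ ap)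
    with coarsenFrom⇒chain S C Cs (ℕP.suc-injective e) (rep-attains w neC) ne cs ap
  ... | cs′ , ch = cB ∷ cs′ , Rxy , ch
    where
    Rxy : R x (rep w C)
    Rxy = let (D , C⊆D , relBD) = head-coarsenFrom S C Cs relB
              (j , j∈B , wj≡x) = xB
              (k , k∈C , wk≡y) = rep-attains w neC
          in subst₂ R wj≡x wk≡y (relBD j k j∈B (C⊆D k∈C))

  chain⇒coarsenFrom : ∀ S B Cs {x} → length S ≡ length Cs → Attains w B x → All Nonempty Cs →
    All (Const w) (B ∷ Cs) → ChainFrom R S x (reps w Cs) →
    All (Const w) (coarsenFrom S B Cs) × AllPairs (Rel w R) (coarsenFrom S B Cs)
  chain⇒coarsenFrom [] B [] _ _ _ cs _ = cs , [] ∷ []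
  chain⇒coarsenFrom (true ∷ S) B (C ∷ Cs) e xB (neC ∷ ne) (cB ∷ cC ∷ cs) (x≡y , ch) =
    chain⇒coarsenFrom S (B ∪ C) Cs (ℕP.suc-injective e) (Attains-∪ʳ yC) ne (cBC ∷ cs) ch
    where
    yC : Attains w C (rep w C)
    yC = rep-attains w neC
    ≡y : ∀ j → j ∈ B ∪ C → w j ≡ rep w C
    ≡y j j∈B∪C with x∈p∪q⁻ B C j∈B∪C
    ... | inj₁ j∈B = trans (Const-attains cB xB j j∈B) x≡y
    ... | inj₂ j∈C = Const-attains cC yC j j∈C
    cBC : Const w (B ∪ C)
    cBC j k j∈ k∈ = trans (≡y j j∈) (sym (≡y k k∈))
  chain⇒coarsenFrom (false ∷ S) B (C ∷ Cs) e xB (neC ∷ ne) (cB ∷ cC ∷ cs) (Rxy , ch)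
    with chain⇒coarsenFrom S C Cs (ℕP.suc-injective e) (rep-attains w neC) ne (cC ∷ cs) ch
  ... | cs′ , ap = cB ∷ cs′ , All.map relB bounds ∷ ap
    where
    y : ℕ
    y = rep w C
    lowerBounds : ∀ Ds → All Nonempty Ds → All (Const w) Ds → All (y ≤_) (reps w Ds) → All (LowerBound w y) Ds
    lowerBounds [] [] [] [] = []
    lowerBounds (D ∷ Ds) (neD ∷ ne) (cD ∷ cs) (y≤ ∷ y≤s) =
      (λ k k∈D → ℕP.≤-trans y≤ (ℕP.≤-reflexive (sym (Const-attains cD (rep-attains w neD) k k∈D))))
      ∷ lowerBounds Ds ne cs y≤s
    bounds : All (LowerBound w y) (coarsenFrom S C Cs)
    bounds = All-coarsenFrom LowerBound-∪ S C Cs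
      (lowerBounds (C ∷ Cs) (neC ∷ ne) (cC ∷ cs) (ℕP.≤-refl ∷ chainFrom⇒lowerBound S y (reps w Cs) ch))
    relB : ∀ {D} → LowerBound w y D → Rel w R B D
    relB lD j k j∈B k∈D = R-≤-trans (subst (λ t → R t y) (sym (Const-attains cB xB j j∈B)) Rxy) (lD k k∈D)

  coarsen⇒chain : ∀ S Bs → length S ≡ ℕ.pred (length Bs) → All Nonempty Bs →
    All (Const w) (coarsen S Bs) → AllPairs (Rel w R) (coarsen S Bs) → All (Const w) Bs × Chain R S (reps w Bs)
  coarsen⇒chain S [] _ _ _ _ = [] , tt
  coarsen⇒chain S (B ∷ Cs) e (neB ∷ ne) = coarsenFrom⇒chain S B Cs e (rep-attains w neB) ne

  chain⇒coarsen : ∀ S Bs → length S ≡ ℕ.pred (length Bs) → All Nonempty Bs →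
    All (Const w) Bs → Chain R S (reps w Bs) → All (Const w) (coarsen S Bs) × AllPairs (Rel w R) (coarsen S Bs)
  chain⇒coarsen S [] _ _ _ _ = [] , []
  chain⇒coarsen S (B ∷ Cs) e (neB ∷ ne) = chain⇒coarsenFrom S B Cs e (rep-attains w neB) ne

AtLeast-Below-⊥ : ∀ r {s} → AtLeast r s → Below r s → ⊥
AtLeast-Below-⊥ (fin k) r≤s s<r = ℕP.<⇒≱ s<r r≤s

≈-sym : ∀ {r n} {σ τ : RSC r n} → σ ≈ τ → τ ≈ σ
≈-sym (Φ≡ , Π↭) = sym Φ≡ , ↭-sym Π↭

AtLeast-∪ : ∀ r {n} {B C : Subset n} → AtLeast r ∣ B ∣ → AtLeast r ∣ B ∪ C ∣
AtLeast-∪ (fin k) {B = B} {C} r≤∣B∣ = ℕP.≤-trans r≤∣B∣ (∣p∣≤∣p∪q∣ B C)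

module _ {r : ℕ∞} {n : ℕ} where

  blocks : RSC r n → List (Subset n)
  blocks σ = Φ σ ++ Π σ

  gaps : RSC r n → ℕ
  gaps σ = ℕ.pred (length (Φ σ))

  module _ (σ : RSC r n) where

    ∈-blockˡ : ∀ {x} l → x ∈ lookup (Φ σ) l → x ∈ lookup (blocks σ) (indexˡ (Φ σ) (Π σ) l)
    ∈-blockˡ {x} l = subst (x ∈_) (sym (lookup-indexˡ (Φ σ) (Π σ) l))

    ∈-blockʳ : ∀ {x} p → x ∈ lookup (Π σ) p → x ∈ lookup (blocks σ) (indexʳ (Φ σ) (Π σ) p)
    ∈-blockʳ {x} p = subst (x ∈_) (sym (lookup-indexʳ (Φ σ) (Π σ) p))

    blockOf : ∀ x → (∃ λ l → x ∈ lookup (Φ σ) l) ⊎ (∃ λ p → x ∈ lookup (Π σ) p)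
    blockOf x with cover σ x
    ... | i , x∈ with index-++ (Φ σ) (Π σ) i
    ...   | inj₁ (l , refl) = inj₁ (l , subst (x ∈_) (lookup-indexˡ (Φ σ) (Π σ) l) x∈)
    ...   | inj₂ (p , refl) = inj₂ (p , subst (x ∈_) (lookup-indexʳ (Φ σ) (Π σ) p) x∈)

    blocks-nonempty : All Nonempty (blocks σ)
    blocks-nonempty = All-fromLookup (blocks σ) (nonempty σ)

    Φ-nonempty : All Nonempty (Φ σ)
    Φ-nonempty = All.++⁻ˡ (Φ σ) blocks-nonempty

  NotBoth : Fin n → Subset n → Subset n → Set
  NotBoth x B C = ¬ (x ∈ B × x ∈ C)

  blocks-disjoint : (σ : RSC r n) → ∀ x → AllPairs (NotBoth x) (blocks σ)
  blocks-disjoint σ x = AllPairs-fromLookup≢ (blocks σ) λ i j i≢j (x∈i , x∈j) → i≢j (disjoint σ x i j x∈i x∈j)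

  NotBoth-∪ˡ : ∀ {x B C D} → NotBoth x B D → NotBoth x C D → NotBoth x (B ∪ C) D
  NotBoth-∪ˡ {B = B} {C} dB dC (x∈B∪C , x∈D) with x∈p∪q⁻ B C x∈B∪C
  ... | inj₁ x∈B = dB (x∈B , x∈D)
  ... | inj₂ x∈C = dC (x∈C , x∈D)

  NotBoth-∪ʳ : ∀ {x B C D} → NotBoth x D B → NotBoth x D C → NotBoth x D (B ∪ C)
  NotBoth-∪ʳ dB dC (x∈D , x∈B∪C) = NotBoth-∪ˡ (dB ∘ swap) (dC ∘ swap) (x∈B∪C , x∈D)

  coarsenRSC : RSC r n → List Bool → RSC r n
  coarsenRSC σ S = record
    { Φ = Φ′
    ; Π = Π σ
    ; nonempty = All-lookup nonempty′
    ; disjoint = disjoint′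
    ; cover = λ x → Any-toLookup (cover′ x)
    ; bigΦ = All-coarsen (λ {B} {C} bB _ → AtLeast-∪ r {B = B} {C} bB) S (Φ σ) (bigΦ σ)
    ; smallΠ = smallΠ σ
    }
    where
    Φ′ = coarsen S (Φ σ)
    nonempty′ : All Nonempty (Φ′ ++ Π σ)
    nonempty′ = let (neΦ , neΠ) = All.++⁻ (Φ σ) (blocks-nonempty σ) in
      All.++⁺ (All-coarsen (λ {B} {C} (j , j∈B) _ → j , p⊆p∪q C j∈B) S (Φ σ) neΦ) neΠ
    cover′ : ∀ x → Any (x ∈_) (Φ′ ++ Π σ)
    cover′ x with Any.++⁻ (Φ σ) (Any-fromLookup (blocks σ) (cover σ x))
    ... | inj₁ x∈Φ = Any.++⁺ˡ (∈-coarsen⁺ S (Φ σ) x∈Φ)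
    ... | inj₂ x∈Π = Any.++⁺ʳ Φ′ x∈Π
    disjoint′ : ∀ x i j → x ∈ lookup (Φ′ ++ Π σ) i → x ∈ lookup (Φ′ ++ Π σ) j → i ≡ j
    disjoint′ x i j x∈i x∈j with i FinP.≟ j
    ... | yes i≡j = i≡j
    ... | no i≢j =
      let (dΦ , dΠ , dΦΠ) = AllPairs-++⁻ (Φ σ) (blocks-disjoint σ x)
          d′ = AllPairs.++⁺ (AllPairs-coarsen NotBoth-∪ˡ NotBoth-∪ʳ S (Φ σ) dΦ) dΠ
                 (All-coarsen (λ dB dC → All.zipWith (λ (d , e) → NotBoth-∪ˡ d e) (dB , dC)) S (Φ σ) dΦΠ)
      in ⊥-elim (AllPairs-lookup≢ (_∘ swap) d′ i j i≢j (x∈i , x∈j))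

  module _ (σ : RSC r n) (S : List Bool) (w : Word n) where

    Separated-coarsen⁺ : Separated σ w → Separated (coarsenRSC σ S) w
    Separated-coarsen⁺ sep p j k j∈ (inj₁ k∈Π) = sep p j k j∈ (inj₁ k∈Π)
    Separated-coarsen⁺ sep p j k j∈ (inj₂ k∈Φ′) =
      sep p j k j∈ (inj₂ (Any-toLookup (∈-coarsen⁻ S (Φ σ) (Any-fromLookup _ k∈Φ′))))

    Separated-coarsen⁻ : Separated (coarsenRSC σ S) w → Separated σ w
    Separated-coarsen⁻ sep p j k j∈ (inj₁ k∈Π) = sep p j k j∈ (inj₁ k∈Π)
    Separated-coarsen⁻ sep p j k j∈ (inj₂ k∈Φ) =
      sep p j k j∈ (inj₂ (Any-toLookup (∈-coarsen⁺ S (Φ σ) (Any-fromLookup _ k∈Φ))))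

  Fits : (ℕ → ℕ → Set) → RSC r n → Word n → Set
  Fits R σ w = All (Const w) (blocks σ) × AllPairs (Rel w R) (Φ σ) × Separated σ w

  FitsUnordered : RSC r n → Word n → Set
  FitsUnordered σ w = All (Const w) (blocks σ) × Separated σ w

  fitsUnordered? : ∀ σ w → Dec (FitsUnordered σ w)
  fitsUnordered? σ w = All.all? const? (blocks σ) ×-dec separated?
    where
    const? : ∀ B → Dec (Const w B)
    const? B = FinP.all? λ j → FinP.all? λ k → (j ∈? B) →-dec ((k ∈? B) →-dec (w j ℕP.≟ w k))
    separated? : Dec (Separated σ w)
    separated? = FinP.all? λ p → FinP.all? λ j → FinP.all? λ k →
      (j ∈? lookup (Π σ) p) →-dec
      ((FinP.any? (λ q → ¬? (q FinP.≟ p) ×-dec (k ∈? lookup (Π σ) q))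
         ⊎-dec FinP.any? (λ l → k ∈? lookup (Φ σ) l))
       →-dec ¬? (w j ℕP.≟ w k))

  module _ {R : ℕ → ℕ → Set} (R-≤-trans : ∀ {a b c} → R a b → b ≤ c → R a c) (R⇒≤ : ∀ {a b} → R a b → a ≤ b)
           (σ : RSC r n) (S : List Bool) (w : Word n) (S-length : length S ≡ gaps σ) where

    Fits-coarsen⁻ : Fits R (coarsenRSC σ S) w → FitsUnordered σ w × Chain R S (reps w (Φ σ))
    Fits-coarsen⁻ (c , ap , sep) =
      let (cΦ′ , cΠ) = All.++⁻ (coarsen S (Φ σ)) c
          (cΦ , ch) = coarsen⇒chain w R-≤-trans R⇒≤ S (Φ σ) S-length (Φ-nonempty σ) cΦ′ ap
      in (All.++⁺ cΦ cΠ , Separated-coarsen⁻ σ S w sep) , ch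

    Fits-coarsen⁺ : FitsUnordered σ w × Chain R S (reps w (Φ σ)) → Fits R (coarsenRSC σ S) w
    Fits-coarsen⁺ ((c , sep) , ch) =
      let (cΦ , cΠ) = All.++⁻ (Φ σ) c
          (cΦ′ , ap) = chain⇒coarsen w R-≤-trans R⇒≤ S (Φ σ) S-length (Φ-nonempty σ) cΦ ch
      in All.++⁺ cΦ′ cΠ , ap , Separated-coarsen⁺ σ S w sep

  module _ (σ : RSC r n) (w : Word n) where

    FCond⇒Fits : FCond σ w → Fits _≤_ σ w
    FCond⇒Fits (same , ord , sep) =
      All-fromLookup (blocks σ) (λ i j k j∈ k∈ → same j k (i , j∈ , k∈)) , AllPairs-fromLookup< (Φ σ) ord , sep

    Fits⇒FCond : Fits _≤_ σ w → FCond σ w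
    Fits⇒FCond (c , ap , sep) = (λ j k (i , j∈ , k∈) → All-lookup c i j k j∈ k∈) , AllPairs-lookup< ap , sep

    MCond⇒Fits : MCond σ w → Fits _<_ σ w
    MCond⇒Fits (same , ord) =
      All-fromLookup (blocks σ) (λ i j k j∈ k∈ → proj₂ (same j k) (i , j∈ , k∈)) , AllPairs-fromLookup< (Φ σ) ord , sep
      where
      sep : Separated σ w
      sep p j k j∈ k∈other wj≡wk with proj₁ (same j k) wj≡wk
      ... | i , j∈i , k∈i with disjoint σ j i _ j∈i (∈-blockʳ σ p j∈)
      ... | refl with k∈other
      ...   | inj₁ (q , q≢p , k∈q) =
                q≢p (sym (indexʳ-injective (Φ σ) (Π σ) (disjoint σ k _ _ k∈i (∈-blockʳ σ q k∈q))))
      ...   | inj₂ (l , k∈l) = indexˡ≢indexʳ (Φ σ) (Π σ) (sym (disjoint σ k _ _ k∈i (∈-blockˡ σ l k∈l)))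

    Fits⇒MCond : Fits _<_ σ w → MCond σ w
    Fits⇒MCond (c , ap , sep) = (λ j k → sameBlock j k , λ (i , j∈ , k∈) → All-lookup c i j k j∈ k∈) , AllPairs-lookup< ap
      where
      sameBlock : ∀ j k → w j ≡ w k → SameBlock σ w j k
      sameBlock j k e with blockOf σ j | blockOf σ k
      ... | inj₁ (l , j∈) | inj₁ (l′ , k∈) with FinP.<-cmp l l′
      ...   | tri< l<l′ _ _ = ⊥-elim (ℕP.<-irrefl e (AllPairs-lookup< ap l l′ l<l′ j k j∈ k∈))
      ...   | tri≈ _ refl _ = indexˡ (Φ σ) (Π σ) l , ∈-blockˡ σ l j∈ , ∈-blockˡ σ l k∈
      ...   | tri> _ _ l′<l = ⊥-elim (ℕP.<-irrefl (sym e) (AllPairs-lookup< ap l′ l l′<l k j k∈ j∈))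
      sameBlock j k e | inj₁ (l , j∈) | inj₂ (p , k∈) = ⊥-elim (sep p k j k∈ (inj₂ (l , j∈)) (sym e))
      sameBlock j k e | inj₂ (p , j∈) | inj₁ (l , k∈) = ⊥-elim (sep p j k j∈ (inj₂ (l , k∈)) e)
      sameBlock j k e | inj₂ (p , j∈) | inj₂ (p′ , k∈) with p′ FinP.≟ p
      ...   | yes refl = indexʳ (Φ σ) (Π σ) p , ∈-blockʳ σ p j∈ , ∈-blockʳ σ p k∈
      ...   | no p′≢p = ⊥-elim (sep p j k j∈ (inj₁ (p′ , p′≢p , k∈)) e)

-- F̄ as a sum of M's, and M as an alternating sum of F̄'s

module _ {r : ℕ∞} {n : ℕ} where

  𝐌-cong : (σ τ : RSC r n) → Φ σ ≡ Φ τ → Π σ ≡ Π τ → 𝐌 σ ≡ 𝐌 τ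
  𝐌-cong record{} record{} refl refl = refl

  𝐅̄-cong : (σ τ : RSC r n) → Φ σ ≡ Φ τ → Π σ ≡ Π τ → 𝐅̄ σ ≡ 𝐅̄ τ
  𝐅̄-cong record{} record{} refl refl = refl

  module _ {R : ℕ → ℕ → Set} (R? : ∀ x y → Dec (R x y))
           (R-≤-trans : ∀ {a b c} → R a b → b ≤ c → R a c) (R⇒≤ : ∀ {a b} → R a b → a ≤ b)
           {Cond : RSC r n → Word n → Set} (cond? : ∀ σ w → Dec (Cond σ w))
           (Cond⇒Fits : ∀ σ w → Cond σ w → Fits R σ w) (Fits⇒Cond : ∀ σ w → Fits R σ w → Cond σ w) where

    indicator-coarsen : ∀ σ S w → length S ≡ gaps σ →
      indicator (cond? (coarsenRSC σ S) w) ≡ indicator (fitsUnordered? σ w) * indicator (chain? R? S (reps w (Φ σ)))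
    indicator-coarsen σ S w S-length = trans
      (indicator-cong (Fits-coarsen⁻ R-≤-trans R⇒≤ σ S w S-length ∘′ Cond⇒Fits _ w)
                      (Fits⇒Cond _ w ∘′ Fits-coarsen⁺ R-≤-trans R⇒≤ σ S w S-length)
                      (cond? (coarsenRSC σ S) w) (fitsUnordered? σ w ×-dec chain? R? S (reps w (Φ σ))))
      (indicator-× (fitsUnordered? σ w) (chain? R? S (reps w (Φ σ))))

  𝐌-coarsen : ∀ σ S w → length S ≡ gaps σ →
    𝐌 (coarsenRSC σ S) w ≡ indicator (fitsUnordered? σ w) * indicator (chain? ℕP._<?_ S (reps w (Φ σ)))
  𝐌-coarsen = indicator-coarsen ℕP._<?_ ℕP.<-≤-trans ℕP.<⇒≤ MCond? MCond⇒Fits Fits⇒MCond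

  𝐅̄-coarsen : ∀ σ S w → length S ≡ gaps σ →
    𝐅̄ (coarsenRSC σ S) w ≡ indicator (fitsUnordered? σ w) * indicator (chain? ℕP._≤?_ S (reps w (Φ σ)))
  𝐅̄-coarsen = indicator-coarsen ℕP._≤?_ ℕP.≤-trans id FCond? FCond⇒Fits Fits⇒FCond

  module _ {R R′ : ℕ → ℕ → Set} (R? : ∀ x y → Dec (R x y)) (R′? : ∀ x y → Dec (R′ x y)) (a : ℚ)
           (split : ∀ x y → a * indicator (x ℕP.≟ y) + indicator (R? x y) ≡ indicator (R′? x y))
           (f g : RSC r n → Series n)
           (f-coarsen : ∀ σ S w → length S ≡ gaps σ →
              f (coarsenRSC σ S) w ≡ indicator (fitsUnordered? σ w) * indicator (chain? R? S (reps w (Φ σ))))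
           (g-coarsen : ∀ σ S w → length S ≡ gaps σ →
              g (coarsenRSC σ S) w ≡ indicator (fitsUnordered? σ w) * indicator (chain? R′? S (reps w (Φ σ))))
           (g-cong : ∀ σ τ → Φ σ ≡ Φ τ → Π σ ≡ Π τ → g σ ≡ g τ) where

    coarsening-expansion : ∀ σ w → g σ w ≡ ∑Bits (gaps σ) (λ S → weight a S * f (coarsenRSC σ S) w)
    coarsening-expansion σ w = sym (begin
        ∑Bits k (λ S → weight a S * f (coarsenRSC σ S) w)
      ≡⟨ ∑Bits-cong k (λ S S-length → trans (cong (weight a S *_) (f-coarsen σ S w S-length))
                                            (x∙yz≈y∙xz (weight a S) u (chain S))) ⟩
        ∑Bits k (λ S → u * (weight a S * chain S))
      ≡⟨ ∑Bits-*ˡ k u _ ⟩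
        u * ∑Bits k (λ S → weight a S * chain S)
      ≡⟨ cong (u *_) (∑Bits-chain R? R′? a split vs (cong ℕ.pred (length-map (rep w) (Φ σ)))) ⟩
        u * indicator (chain? R′? (falses k) vs)
      ≡⟨ sym (g-coarsen σ (falses k) w (length-replicate k)) ⟩
        g (coarsenRSC σ (falses k)) w
      ≡⟨ cong-app (g-cong _ σ (coarsen-falses (Φ σ)) refl) w ⟩
        g σ w
      ∎)
      where
      open ≡-Reasoning
      k = gaps σ
      vs = reps w (Φ σ)
      u = indicator (fitsUnordered? σ w)
      chain = λ S → indicator (chain? R? S vs)

  𝐅̄-expansion : ∀ σ w → 𝐅̄ σ w ≡ ∑Bits (gaps σ) (λ S → weight 1ℚ S * 𝐌 (coarsenRSC σ S) w)
  𝐅̄-expansion = coarsening-expansion ℕP._<?_ ℕP._≤?_ 1ℚ indicator-≟+<≡≤ 𝐌 𝐅̄ 𝐌-coarsen 𝐅̄-coarsen 𝐅̄-cong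

  𝐌-expansion : ∀ σ w → 𝐌 σ w ≡ ∑Bits (gaps σ) (λ S → weight (- 1ℚ) S * 𝐅̄ (coarsenRSC σ S) w)
  𝐌-expansion = coarsening-expansion ℕP._≤?_ ℕP._<?_ (- 1ℚ) indicator-≤-≟≡< 𝐅̄ 𝐌 𝐅̄-coarsen 𝐌-coarsen 𝐌-cong

-- The r-set-composition determined by a word

module _ {r : ℕ∞} {n : ℕ} where

  blockWord : RSC r n → Word n
  blockWord σ x = toℕ (proj₁ (cover σ x))

  MCond-blockWord : ∀ σ → MCond σ (blockWord σ)
  MCond-blockWord σ = (λ j k → sameBlock j k , sameWord j k) , ordered
    where
    index-unique : ∀ {x} i → x ∈ lookup (blocks σ) i → proj₁ (cover σ x) ≡ i
    index-unique {x} i x∈i = disjoint σ x _ i (proj₂ (cover σ x)) x∈i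
    sameBlock : ∀ j k → blockWord σ j ≡ blockWord σ k → SameBlock σ (blockWord σ) j k
    sameBlock j k e with cover σ j | cover σ k
    ... | i , j∈ | i′ , k∈ with FinP.toℕ-injective e
    ...   | refl = i , j∈ , k∈
    sameWord : ∀ j k → SameBlock σ (blockWord σ) j k → blockWord σ j ≡ blockWord σ k
    sameWord j k (i , j∈ , k∈) = cong toℕ (trans (index-unique i j∈) (sym (index-unique i k∈)))
    ordered : Ordered σ (blockWord σ) _<_
    ordered l m l<m j k j∈ k∈ = subst₂ _<_ (sym (position l j∈)) (sym (position m k∈)) l<m
      where
      position : ∀ {x} l → x ∈ lookup (Φ σ) l → blockWord σ x ≡ toℕ l
      position l x∈ = trans (cong toℕ (index-unique _ (∈-blockˡ σ l x∈))) (toℕ-indexˡ (Φ σ) (Π σ) l)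

  module _ (σ : RSC r n) {w : Word n} (mσ : MCond σ w) where

    block⇒fibre : ∀ i {b x} → b ∈ lookup (blocks σ) i → x ∈ lookup (blocks σ) i → w x ≡ w b
    block⇒fibre i b∈ x∈ = proj₂ (proj₁ mσ _ _) (i , x∈ , b∈)

    fibre⇒block : ∀ i {b x} → b ∈ lookup (blocks σ) i → w x ≡ w b → x ∈ lookup (blocks σ) i
    fibre⇒block i {b} b∈ e with proj₁ (proj₁ mσ _ b) e
    ... | i′ , x∈ , b∈′ with disjoint σ b i′ i b∈′ b∈
    ...   | refl = x∈

  -- Under MCond the blocks are the level sets of the word, hence determined by it.
  module _ (σ τ : RSC r n) {w : Word n} (mσ : MCond σ w) (mτ : MCond τ w) where

    block-transfer : ∀ {B} → B ∈ₗ blocks σ → B ∈ₗ blocks τ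
    block-transfer B∈ with Any-toLookup B∈
    ... | i , refl with nonempty σ i
    ...   | b , b∈ with cover τ b
    ...     | i′ , b∈′ = subst (_∈ₗ blocks τ) (⊆-antisym τ⊆σ σ⊆τ) (∈-lookup i′)
      where
      σ⊆τ : lookup (blocks σ) i ⊆ lookup (blocks τ) i′
      σ⊆τ x∈ = fibre⇒block τ mτ i′ b∈′ (block⇒fibre σ mσ i b∈ x∈)
      τ⊆σ : lookup (blocks τ) i′ ⊆ lookup (blocks σ) i
      τ⊆σ x∈ = fibre⇒block σ mσ i b∈ (block⇒fibre τ mτ i′ b∈′ x∈)

    Φ-transfer : ∀ {B} → B ∈ₗ Φ σ → B ∈ₗ Φ τ
    Φ-transfer B∈ with Any.++⁻ (Φ τ) (block-transfer (Any.++⁺ˡ B∈))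
    ... | inj₁ B∈Φ = B∈Φ
    ... | inj₂ B∈Π = ⊥-elim (AtLeast-Below-⊥ r (All.lookup (bigΦ σ) B∈) (All.lookup (smallΠ τ) B∈Π))

    Π-transfer : ∀ {B} → B ∈ₗ Π σ → B ∈ₗ Π τ
    Π-transfer B∈ with Any.++⁻ (Φ τ) (block-transfer (Any.++⁺ʳ (Φ σ) B∈))
    ... | inj₂ B∈Π = B∈Π
    ... | inj₁ B∈Φ = ⊥-elim (AtLeast-Below-⊥ r (All.lookup (bigΦ τ) B∈Φ) (All.lookup (smallΠ σ) B∈))

  Π-unique : ∀ (σ : RSC r n) → Unique (Π σ)
  Π-unique σ = AllPairs-fromLookup≢ (Π σ) λ p q p≢q Πp≡Πq →
    let (x , x∈p) = nonempty σ (indexʳ (Φ σ) (Π σ) p)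
        x∈q = ∈-blockʳ σ q (subst (x ∈_) (trans (lookup-indexʳ (Φ σ) (Π σ) p) Πp≡Πq) x∈p)
    in p≢q (indexʳ-injective (Φ σ) (Π σ) (disjoint σ x _ _ x∈p x∈q))

  MCond-unique : ∀ σ τ {w} → MCond σ w → MCond τ w → σ ≈ τ
  MCond-unique σ τ {w} mσ mτ =
    AllPairs-ext <-asym (Φ-nonempty σ) (Φ-nonempty τ) (proj₁ (proj₂ (MCond⇒Fits σ w mσ)))
                 (proj₁ (proj₂ (MCond⇒Fits τ w mτ))) (Φ-transfer σ τ mσ mτ) (Φ-transfer τ σ mτ mσ) ,
    ∼bag⇒↭ (unique∧set⇒bag (Π-unique σ) (Π-unique τ) (mk⇔ (Π-transfer σ τ mσ mτ) (Π-transfer τ σ mτ mσ)))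
    where
    <-asym : ∀ {B C} → Nonempty B → Nonempty C → Rel w _<_ B C → Rel w _<_ C B → ⊥
    <-asym (j , j∈) (k , k∈) B<C C<B = ℕP.<-asym (B<C j k j∈ k∈) (C<B k j k∈ j∈)

  MCond⇒FCond : ∀ (σ : RSC r n) w → MCond σ w → FCond σ w
  MCond⇒FCond σ w m with MCond⇒Fits σ w m
  ... | c , ap , sep = Fits⇒FCond σ w (c , AllPairs.map {R = Rel w _<_} <⇒≤ ap , sep)
    where
    <⇒≤ : ∀ {B C} → Rel w _<_ B C → Rel w _≤_ B C
    <⇒≤ B<C j k j∈ k∈ = ℕP.<⇒≤ (B<C j k j∈ k∈)

  -- F̄_τ expands into the M's of the coarsenings of τ, so one of them is σ.
  FCond-triangular : ∀ (σ τ : RSC r n) w → MCond σ w → FCond τ w → length (Φ τ) ≤ length (Φ σ) → τ ≈ σ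
  FCond-triangular σ τ w mσ fτ τ≤σ with ∑Bits≢0 (gaps τ) (λ S → weight 1ℚ S * 𝐌 (coarsenRSC τ S) w) expansion≢0
    where
    expansion≢0 : ∑Bits (gaps τ) (λ S → weight 1ℚ S * 𝐌 (coarsenRSC τ S) w) ≢ 0ℚ
    expansion≢0 e = ℚP.1≢0 (trans (sym (indicator-yes fτ (FCond? τ w))) (trans (𝐅̄-expansion τ w) e))
  ... | S , _ , term≢0 with MCond-unique (coarsenRSC τ S) σ (indicator≢0 (MCond? (coarsenRSC τ S) w) (M≢0 S term≢0)) mσ
    where
    M≢0 : ∀ S → weight 1ℚ S * 𝐌 (coarsenRSC τ S) w ≢ 0ℚ → 𝐌 (coarsenRSC τ S) w ≢ 0ℚ
    M≢0 S term≢0 M≡0 = term≢0 (trans (cong (weight 1ℚ S *_) M≡0) (ℚP.*-zeroʳ (weight 1ℚ S)))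
  ... | Φ≡ , Π↭ = trans (sym (coarsen-≥ S (Φ τ) (subst (length (Φ τ) ≤_) (cong length (sym Φ≡)) τ≤σ))) Φ≡ , Π↭

-- Spanning and linear independence

module _ {r : ℕ∞} {n : ℕ} where

  lincomb-++ : ∀ (f : RSC r n → Series n) L L′ w → lincomb f (L ++ L′) w ≡ lincomb f L w + lincomb f L′ w
  lincomb-++ f [] L′ w = sym (ℚP.+-identityˡ _)
  lincomb-++ f ((c , σ) ∷ L) L′ w =
    trans (cong (c * f σ w +_) (lincomb-++ f L L′ w)) (sym (ℚP.+-assoc (c * f σ w) _ _))

  lincomb-tabulateBits : ∀ (f : RSC r n → Series n) k (g : List Bool → ℚ × RSC r n) w →
    lincomb f (tabulateBits k g) w ≡ ∑Bits k (λ S → proj₁ (g S) * f (proj₂ (g S)) w)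
  lincomb-tabulateBits f zero g w = ℚP.+-identityʳ _
  lincomb-tabulateBits f (suc k) g w =
    trans (lincomb-++ f (tabulateBits k _) (tabulateBits k _) w)
          (cong₂ _+_ (lincomb-tabulateBits f k _ w) (lincomb-tabulateBits f k _ w))

  scale : ℚ → List (ℚ × RSC r n) → List (ℚ × RSC r n)
  scale c = map (λ (d , σ) → c * d , σ)

  lincomb-scale : ∀ (f : RSC r n → Series n) c L w → lincomb f (scale c L) w ≡ c * lincomb f L w
  lincomb-scale f c [] w = sym (ℚP.*-zeroʳ c)
  lincomb-scale f c ((d , σ) ∷ L) w =
    trans (cong₂ _+_ (ℚP.*-assoc c d (f σ w)) (lincomb-scale f c L w))
          (sym (ℚP.*-distribˡ-+ c (d * f σ w) _))

  InSpan-trans : ∀ (f g : RSC r n → Series n) → (∀ σ → InSpan g (f σ)) → ∀ S → InSpan f S → InSpan g S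
  InSpan-trans f g f∈g S (L , S≡) = substitute L , λ w → trans (S≡ w) (sym (lincomb-substitute L w))
    where
    substitute : List (ℚ × RSC r n) → List (ℚ × RSC r n)
    substitute [] = []
    substitute ((c , σ) ∷ L) = scale c (proj₁ (f∈g σ)) ++ substitute L
    lincomb-substitute : ∀ L w → lincomb g (substitute L) w ≡ lincomb f L w
    lincomb-substitute [] w = refl
    lincomb-substitute ((c , σ) ∷ L) w =
      trans (lincomb-++ g (scale c (proj₁ (f∈g σ))) (substitute L) w)
            (cong₂ _+_ (trans (lincomb-scale g c (proj₁ (f∈g σ)) w) (cong (c *_) (sym (proj₂ (f∈g σ) w))))
                       (lincomb-substitute L w))

  lincomb-zero : ∀ (f : RSC r n → Series n) L w → (∀ {x} → x ∈ₗ L → proj₁ x * f (proj₂ x) w ≡ 0ℚ) →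
    lincomb f L w ≡ 0ℚ
  lincomb-zero f [] w _ = refl
  lincomb-zero f (x ∷ L) w terms≡0 =
    trans (cong₂ _+_ (terms≡0 (here refl)) (lincomb-zero f L w (terms≡0 ∘ there))) (ℚP.+-identityʳ 0ℚ)

  lincomb-isolate : ∀ (f : RSC r n → Series n) L {e} w → e ∈ₗ L → AllPairs (λ a b → ¬ (proj₂ a ≈ proj₂ b)) L →
    f (proj₂ e) w ≡ 1ℚ → (∀ {x} → x ∈ₗ L → ¬ (proj₂ x ≈ proj₂ e) → proj₁ x * f (proj₂ x) w ≡ 0ℚ) →
    lincomb f L w ≡ proj₁ e
  lincomb-isolate f (x ∷ L) {e} w (here refl) (e≉ ∷ _) fe≡1 others =
    trans (cong₂ _+_ (trans (cong (proj₁ e *_) fe≡1) (ℚP.*-identityʳ (proj₁ e)))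
                     (lincomb-zero f L w λ {y} y∈ → others (there y∈) (All.lookup e≉ y∈ ∘ ≈-sym {σ = proj₂ y} {proj₂ e})))
          (ℚP.+-identityʳ (proj₁ e))
  lincomb-isolate f (x ∷ L) {e} w (there e∈) (x≉ ∷ distinct) fe≡1 others =
    trans (cong₂ _+_ (others (here refl) (All.lookup x≉ e∈))
                     (lincomb-isolate f L w e∈ distinct fe≡1 (others ∘ there)))
          (ℚP.+-identityˡ (proj₁ e))

  module _ (f : RSC r n → Series n) (word : RSC r n → Word n) (rank : RSC r n → ℕ)
           (f-diagonal : ∀ σ → f σ (word σ) ≡ 1ℚ)
           (f-triangular : ∀ σ τ → f τ (word σ) ≢ 0ℚ → rank τ ≤ rank σ → τ ≈ σ) where

    triangular⇒LinIndep : LinIndep f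
    triangular⇒LinIndep L distinct vanishes =
      All.tabulate λ {e} e∈ → coefficient≡0 maxRank e∈ (ℕP.m≤n+m maxRank (rank (proj₂ e)))
      where
      maxRank : ℕ
      maxRank = max 0 (map (rank ∘ proj₂) L)

      rank≤max : ∀ {x} → x ∈ₗ L → rank (proj₂ x) ≤ maxRank
      rank≤max x∈ = All.lookup (xs≤max 0 (map (rank ∘ proj₂) L)) (∈-map⁺ (rank ∘ proj₂) x∈)

      -- Evaluating at word e, only e survives once the coefficients of higher rank are known to vanish.
      isolate : ∀ {e} → e ∈ₗ L → (∀ {x} → x ∈ₗ L → rank (proj₂ e) < rank (proj₂ x) → proj₁ x ≡ 0ℚ) → proj₁ e ≡ 0ℚ
      isolate {e} e∈ higher≡0 =
        trans (sym (lincomb-isolate f L (word (proj₂ e)) e∈ distinct (f-diagonal (proj₂ e)) others))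
              (vanishes (word (proj₂ e)))
        where
        others : ∀ {x} → x ∈ₗ L → ¬ (proj₂ x ≈ proj₂ e) → proj₁ x * f (proj₂ x) (word (proj₂ e)) ≡ 0ℚ
        others {x} x∈ x≉e with f (proj₂ x) (word (proj₂ e)) ℚP.≟ 0ℚ
        ... | yes fx≡0 = trans (cong (proj₁ x *_) fx≡0) (ℚP.*-zeroʳ (proj₁ x))
        ... | no fx≢0 with rank (proj₂ x) ℕP.≤? rank (proj₂ e)
        ...   | yes x≤e = ⊥-elim (x≉e (f-triangular (proj₂ e) (proj₂ x) fx≢0 x≤e))
        ...   | no x≰e = trans (cong (_* f (proj₂ x) (word (proj₂ e))) (higher≡0 x∈ (ℕP.≰⇒> x≰e)))
                                 (ℚP.*-zeroˡ (f (proj₂ x) (word (proj₂ e))))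

      coefficient≡0 : ∀ k {e} → e ∈ₗ L → maxRank ≤ rank (proj₂ e) ℕ.+ k → proj₁ e ≡ 0ℚ
      coefficient≡0 zero {e} e∈ max≤ = isolate e∈ λ x∈ e<x →
        ⊥-elim (ℕP.<⇒≱ e<x (ℕP.≤-trans (rank≤max x∈) (subst (maxRank ≤_) (ℕP.+-identityʳ _) max≤)))
      coefficient≡0 (suc k) {e} e∈ max≤ = isolate e∈ λ {x} x∈ e<x →
        coefficient≡0 k x∈ (ℕP.≤-trans max≤ (subst (_≤ rank (proj₂ x) ℕ.+ k) (sym (ℕP.+-suc _ k)) (ℕP.+-monoˡ-≤ k e<x)))

  𝐅̄∈NCQSym : ∀ σ → NCQSym r n (𝐅̄ σ)
  𝐅̄∈NCQSym σ = tabulateBits (gaps σ) (λ S → weight 1ℚ S , coarsenRSC σ S) ,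
    λ w → trans (𝐅̄-expansion σ w) (sym (lincomb-tabulateBits 𝐌 (gaps σ) _ w))

  𝐌∈span𝐅̄ : ∀ σ → InSpan 𝐅̄ (𝐌 σ)
  𝐌∈span𝐅̄ σ = tabulateBits (gaps σ) (λ S → weight (- 1ℚ) S , coarsenRSC σ S) ,
    λ w → trans (𝐌-expansion σ w) (sym (lincomb-tabulateBits 𝐅̄ (gaps σ) _ w))

  𝐌∈NCQSym : ∀ σ → NCQSym r n (𝐌 σ)
  𝐌∈NCQSym σ = (1ℚ , σ) ∷ [] , λ w → sym (trans (ℚP.+-identityʳ (1ℚ * 𝐌 σ w)) (ℚP.*-identityˡ (𝐌 σ w)))

  𝐌-linIndep : LinIndep {r} {n} 𝐌
  𝐌-linIndep = triangular⇒LinIndep 𝐌 blockWord (λ _ → 0)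
    (λ σ → indicator-yes (MCond-blockWord σ) (MCond? σ (blockWord σ)))
    (λ σ τ M≢0 _ → MCond-unique τ σ (indicator≢0 (MCond? τ (blockWord σ)) M≢0) (MCond-blockWord σ))

  𝐅̄-linIndep : LinIndep {r} {n} 𝐅̄
  𝐅̄-linIndep = triangular⇒LinIndep 𝐅̄ blockWord (length ∘ Φ)
    (λ σ → indicator-yes (MCond⇒FCond σ (blockWord σ) (MCond-blockWord σ)) (FCond? σ (blockWord σ)))
    (λ σ τ F≢0 → FCond-triangular σ τ (blockWord σ) (MCond-blockWord σ) (indicator≢0 (FCond? τ (blockWord σ)) F≢0))

mainTheorem19 : (r : ℕ∞) → Positive r → (n : ℕ) →
    IsBasisOfNCQSym r n 𝐌 × IsBasisOfNCQSym r n 𝐅̄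
mainTheorem19 r _ n =
  (𝐌∈NCQSym , (λ S S∈NCQSym → S∈NCQSym) , 𝐌-linIndep) ,
  (𝐅̄∈NCQSym , InSpan-trans 𝐌 𝐅̄ 𝐌∈span𝐅̄ , 𝐅̄-linIndep)
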